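{- Let $d\geq1$. Then $A_{2d,d}$ is a weighing matrix of weight $d^2$ and order $\binom{2d}{d}$, i.e. $A_{2d,d}A_{2d,d}^T=d^2I$.
   Context: A weighing matrix of weight $w$ and order $N$ is an $N\times N$ matrix $A$ with entries in $\{0,1,-1\}$ such that $AA^T=wI_N$. Let $\mathcal{B}_{n,d}$ be the set of binary words of length $n$ with exactly $d$ ones. For $\alpha=a_1\cdots a_n,\beta=b_1\cdots b_n\in\mathcal{B}_{n,d}$ differing in exactly two positions $i<j$, let $h(\alpha,\beta)=|\{\ell:a_\ell=b_\ell=1,\ i<\ell<j\}|$. $A_{n,d}$ is the matrix indexed by $\mathcal{B}_{n,d}$ with $A_{n,d}(\alpha,\beta)=(-1)^{h(\alpha,\beta)}$ if $\alpha,\beta$ differ in exactly two positions and $0$ otherwise. -}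

module Defs where

open import Data.Bool using (Bool; true; false; _∧_; not; if_then_else_)
open import Data.Bool.Properties using () renaming (_≟_ to _≟B_)
open import Data.Nat using (ℕ; zero; suc; _<ᵇ_; _≡ᵇ_)
open import Data.Nat.Properties using () renaming (_≟_ to _≟ℕ_)
open import Data.Fin using (Fin; toℕ)
open import Data.List using (List; []; _∷_; map; filter; length; concatMap; allFin; foldr)
open import Data.Vec using (Vec; []; _∷_; lookup; count)
open import Data.Vec.Properties using (≡-dec)
open import Data.Integer using (ℤ; +_; -_; _*_; _+_)
open import Relation.Binary.PropositionalEquality using (_≡_)
open import Relation.Nullary using (does)

weight : ∀ {n} → Vec Bool n → ℕ
weight v = count (λ b → b ≟B true) v

allWords : (n : ℕ) → List (Vec Bool n)
allWords zero = [] ∷ []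
allWords (suc n) = concatMap (λ w → (false ∷ w) ∷ (true ∷ w) ∷ []) (allWords n)

B : (n d : ℕ) → List (Vec Bool n)
B n d = filter (λ v → weight v ≟ℕ d) (allWords n)

diffPositions : ∀ {n} → Vec Bool n → Vec Bool n → List (Fin n)
diffPositions {n} α β = filter (λ i → not (does (lookup α i ≟B lookup β i)) ≟B true) (allFin n)

h : ∀ {n} → Vec Bool n → Vec Bool n → Fin n → Fin n → ℕ
h {n} α β i j =
  length (filter (λ ℓ → (lookup α ℓ ∧ lookup β ℓ ∧ (toℕ i <ᵇ toℕ ℓ) ∧ (toℕ ℓ <ᵇ toℕ j)) ≟B true) (allFin n))

negOnePow : ℕ → ℤ
negOnePow zero = + 1
negOnePow (suc k) = - negOnePow k

Aentry : ∀ {n} → Vec Bool n → Vec Bool n → ℤ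
Aentry α β with diffPositions α β
... | i ∷ j ∷ [] = negOnePow (h α β i j)
... | _ = + 0

sumℤ : List ℤ → ℤ
sumℤ = foldr _+_ (+ 0)

AAT : (n d : ℕ) → Vec Bool n → Vec Bool n → ℤ
AAT n d α β = sumℤ (map (λ γ → Aentry α γ * Aentry β γ) (B n d))

δ : ∀ {n} → Vec Bool n → Vec Bool n → ℤ
δ α β = if does (≡-dec _≟B_ α β) then + 1 else + 0

{-# OPTIONS --safe #-}
module Submission where

open import Defs
open import Data.Bool using (Bool; true; false; not; _∧_; if_then_else_)
open import Data.Bool.Properties using (∧-zeroʳ) renaming (_≟_ to _≟B_)
open import Data.Empty using (⊥-elim)
open import Data.Fin using (Fin; zero; suc; toℕ)
open import Data.Integer using (ℤ; +_; -_; _+_; _-_; _*_)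
open import Data.Integer.Properties
  using (+-identityˡ; +-identityʳ; +-inverseʳ; +-assoc; +-comm; *-identityˡ; *-zeroʳ; *-comm; *-assoc;
         *-distribˡ-+; neg-distrib-+; suc-*; pos-*)
open import Data.Integer.Tactic.RingSolver using (solve-∀)
open import Data.List using (List; []; _∷_; map; concatMap; filter; length; allFin; null)
open import Data.List.Properties using (map-cong; map-tabulate; length-map; filter-none; filter-≐)
open import Data.List.Membership.Propositional using (_∈_)
open import Data.List.Membership.Propositional.Properties using (∈-filter⁻)
open import Data.List.Relation.Unary.All using (universal)
open import Data.Nat as ℕ using (ℕ; zero; suc; _≤_)
open import Data.Nat.Combinatorics using (_C_; nCk+nC[k+1]≡[n+1]C[k+1])
open import Data.Nat.Properties using (suc-injective; m≢1+n+m; +-suc) renaming (+-comm to ℕ-+-comm; _≟_ to _≟ℕ_)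
open import Data.Product using (_×_; _,_; proj₂)
open import Data.Sum using (_⊎_; inj₁; inj₂)
open import Data.Vec using (Vec; []; _∷_; lookup)
open import Data.Vec.Properties using (≡-dec)
open import Relation.Binary.PropositionalEquality using (_≡_; _≢_; refl; sym; trans; cong; cong₂; module ≡-Reasoning)
open import Relation.Nullary using (does; yes; no; ¬_)
open import Relation.Unary using (Pred; Decidable)

-- Index matrices by all binary words of length n and let C be the sum of the Jordan–Wigner
-- creation operators, so that C² = 0 and CᵀC + CCᵀ = n I.  The hopping matrix H = CᵀC preserves
-- weight and agrees with A_{n,d} + d I on words of weight d.  Hence H² = Cᵀ (CCᵀ) C =
-- Cᵀ (n I - CᵀC) C = n H, and (H - d I)² = (n - 2d) H + d² I, which is d² I when n = 2d.
-- Since H - d I vanishes between words of different weights, the product over B_{2d,d}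
-- is the restriction of (H - d I)² computed over all words.

module _ {A : Set} where

  ∑ : List A → (A → ℤ) → ℤ
  ∑ xs f = sumℤ (map f xs)

  ∑-cong : ∀ xs {f g : A → ℤ} → (∀ x → f x ≡ g x) → ∑ xs f ≡ ∑ xs g
  ∑-cong xs f≗g = cong sumℤ (map-cong f≗g xs)

  ∑-zero : ∀ xs → ∑ xs (λ _ → + 0) ≡ + 0
  ∑-zero []       = refl
  ∑-zero (x ∷ xs) = trans (+-identityˡ _) (∑-zero xs)

  ∑-+ : ∀ xs (f g : A → ℤ) → ∑ xs (λ x → f x + g x) ≡ ∑ xs f + ∑ xs g
  ∑-+ []       f g = refl
  ∑-+ (x ∷ xs) f g = begin
    f x + g x + ∑ xs (λ x → f x + g x) ≡⟨ cong (_+_ (f x + g x)) (∑-+ xs f g) ⟩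
    f x + g x + (∑ xs f + ∑ xs g)      ≡⟨ interchange (f x) (g x) _ _ ⟩
    f x + ∑ xs f + (g x + ∑ xs g)      ∎
    where
    open ≡-Reasoning
    interchange : ∀ a b c d → a + b + (c + d) ≡ a + c + (b + d)
    interchange = solve-∀

  ∑-*ˡ : ∀ xs c (f : A → ℤ) → ∑ xs (λ x → c * f x) ≡ c * ∑ xs f
  ∑-*ˡ []       c f = sym (*-zeroʳ c)
  ∑-*ˡ (x ∷ xs) c f = trans (cong (_+_ (c * f x)) (∑-*ˡ xs c f)) (sym (*-distribˡ-+ c (f x) _))

  ∑-*ʳ : ∀ xs c (f : A → ℤ) → ∑ xs (λ x → f x * c) ≡ ∑ xs f * c
  ∑-*ʳ xs c f = trans (∑-cong xs (λ x → *-comm (f x) c)) (trans (∑-*ˡ xs c f) (*-comm c _))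

  ∑-*-zero : ∀ xs (f : A → ℤ) → ∑ xs (λ x → f x * + 0) ≡ + 0
  ∑-*-zero xs f = trans (∑-cong xs (λ x → *-zeroʳ (f x))) (∑-zero xs)

  ∑-neg : ∀ xs (f : A → ℤ) → ∑ xs (λ x → - f x) ≡ - ∑ xs f
  ∑-neg []       f = refl
  ∑-neg (x ∷ xs) f = trans (cong (_+_ (- f x)) (∑-neg xs f)) (sym (neg-distrib-+ (f x) _))

  ∑-neg-neg : ∀ xs (f g : A → ℤ) → ∑ xs (λ x → - f x * - g x) ≡ ∑ xs (λ x → f x * g x)
  ∑-neg-neg xs f g = ∑-cong xs (λ x → neg-*-neg (f x) (g x))
    where
    neg-*-neg : ∀ a b → - a * - b ≡ a * b
    neg-*-neg = solve-∀

  ∑-- : ∀ xs (f g : A → ℤ) → ∑ xs (λ x → f x - g x) ≡ ∑ xs f - ∑ xs g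
  ∑-- xs f g = trans (∑-+ xs f (λ x → - g x)) (cong (_+_ (∑ xs f)) (∑-neg xs g))

  ∑-swap : ∀ xs ys (f : A → A → ℤ) → ∑ xs (λ x → ∑ ys (f x)) ≡ ∑ ys (λ y → ∑ xs (λ x → f x y))
  ∑-swap []       ys f = sym (∑-zero ys)
  ∑-swap (x ∷ xs) ys f =
    trans (cong (_+_ (∑ ys (f x))) (∑-swap xs ys f)) (sym (∑-+ ys (f x) (λ y → ∑ xs (λ x → f x y))))

  ∑-filter : ∀ {ℓ} {P : Pred A ℓ} (P? : Decidable P) (f g : A → ℤ) →
             (∀ x → P x → f x ≡ g x) → (∀ x → ¬ P x → g x ≡ + 0) →
             ∀ xs → ∑ (filter P? xs) f ≡ ∑ xs g
  ∑-filter P? f g f≡g g≡0 []       = refl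
  ∑-filter P? f g f≡g g≡0 (x ∷ xs) with P? x
  ... | yes px = cong₂ _+_ (f≡g x px) (∑-filter P? f g f≡g g≡0 xs)
  ... | no ¬px = trans (∑-filter P? f g f≡g g≡0 xs) (sym (trans (cong (_+ ∑ xs g) (g≡0 x ¬px)) (+-identityˡ _)))

sub-*-zeroʳ : ∀ a x → a - x * + 0 ≡ a
sub-*-zeroʳ a x = trans (cong (λ y → a - y) (*-zeroʳ x)) (+-identityʳ a)

module Matrices {I : Set} (indices : List I) where

  Matrix : Set
  Matrix = I → I → ℤ

  infixl 7 _⊙_
  infix 8 _ᵀ

  _⊙_ : Matrix → Matrix → Matrix
  (X ⊙ Y) u w = ∑ indices (λ v → X u v * Y v w)

  _ᵀ : Matrix → Matrix
  (X ᵀ) u w = X w u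

  ⊙-assoc : ∀ X Y Z u w → (X ⊙ Y ⊙ Z) u w ≡ (X ⊙ (Y ⊙ Z)) u w
  ⊙-assoc X Y Z u w = begin
    ∑ indices (λ y → ∑ indices (λ x → X u x * Y x y) * Z y w)
      ≡⟨ ∑-cong indices (λ y → sym (∑-*ʳ indices (Z y w) _)) ⟩
    ∑ indices (λ y → ∑ indices (λ x → X u x * Y x y * Z y w))
      ≡⟨ ∑-swap indices indices _ ⟩
    ∑ indices (λ x → ∑ indices (λ y → X u x * Y x y * Z y w))
      ≡⟨ ∑-cong indices (λ x → trans (∑-cong indices (λ y → *-assoc (X u x) _ _)) (∑-*ˡ indices (X u x) _)) ⟩
    ∑ indices (λ x → X u x * ∑ indices (λ y → Y x y * Z y w)) ∎
    where open ≡-Reasoning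

Word : ℕ → Set
Word n = Vec Bool n

open module WordMatrices {n} = Matrices (allWords n)

∑-allWords-suc : ∀ n (f : Word (suc n) → ℤ) →
  ∑ (allWords (suc n)) f ≡ ∑ (allWords n) (λ w → f (false ∷ w)) + ∑ (allWords n) (λ w → f (true ∷ w))
∑-allWords-suc n f = go (allWords n)
  where
  go : ∀ ws → ∑ (concatMap (λ w → (false ∷ w) ∷ (true ∷ w) ∷ []) ws) f
            ≡ ∑ ws (λ w → f (false ∷ w)) + ∑ ws (λ w → f (true ∷ w))
  go []       = refl
  go (w ∷ ws) =
    trans (cong (λ s → f (false ∷ w) + (f (true ∷ w) + s)) (go ws)) (shuffle (f (false ∷ w)) (f (true ∷ w)) _ _)
    where
    shuffle : ∀ a b c d → a + (b + (c + d)) ≡ a + c + (b + d)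
    shuffle = solve-∀

δ-sym : ∀ {n} (u w : Word n) → δ u w ≡ δ w u
δ-sym []          []          = refl
δ-sym (false ∷ u) (false ∷ w) = δ-sym u w
δ-sym (false ∷ u) (true ∷ w)  = refl
δ-sym (true ∷ u)  (false ∷ w) = refl
δ-sym (true ∷ u)  (true ∷ w)  = δ-sym u w

δ≡0⊎≡ : ∀ {n} (u w : Word n) → δ u w ≡ + 0 ⊎ u ≡ w
δ≡0⊎≡ u w with ≡-dec _≟B_ u w
... | yes u≡w = inj₂ u≡w
... | no _    = inj₁ refl

∑-δ : ∀ {n} (u : Word n) (f : Word n → ℤ) → ∑ (allWords n) (λ v → δ u v * f v) ≡ f u
∑-δ []          f = trans (+-identityʳ _) (*-identityˡ _)
∑-δ {suc n} (false ∷ u) f = begin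
  ∑ (allWords (suc n)) (λ v → δ (false ∷ u) v * f v)
    ≡⟨ ∑-allWords-suc n _ ⟩
  ∑ (allWords n) (λ v → δ u v * f (false ∷ v)) + ∑ (allWords n) (λ _ → + 0)
    ≡⟨ cong₂ _+_ (∑-δ u _) (∑-zero (allWords n)) ⟩
  f (false ∷ u) + + 0
    ≡⟨ +-identityʳ _ ⟩
  f (false ∷ u) ∎
  where open ≡-Reasoning
∑-δ {suc n} (true ∷ u) f = begin
  ∑ (allWords (suc n)) (λ v → δ (true ∷ u) v * f v)
    ≡⟨ ∑-allWords-suc n _ ⟩
  ∑ (allWords n) (λ _ → + 0) + ∑ (allWords n) (λ v → δ u v * f (true ∷ v))
    ≡⟨ cong₂ _+_ (∑-zero (allWords n)) (∑-δ u _) ⟩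
  + 0 + f (true ∷ u)
    ≡⟨ +-identityˡ _ ⟩
  f (true ∷ u) ∎
  where open ≡-Reasoning

∑-δˡ : ∀ {n} (u : Word n) (f : Word n → ℤ) → ∑ (allWords n) (λ v → δ v u * f v) ≡ f u
∑-δˡ u f = trans (∑-cong (allWords _) (λ v → cong (_* f v) (δ-sym v u))) (∑-δ u f)

∑-δʳ : ∀ {n} (u : Word n) (f : Word n → ℤ) → ∑ (allWords n) (λ v → f v * δ u v) ≡ f u
∑-δʳ u f = trans (∑-cong (allWords _) (λ v → *-comm (f v) (δ u v))) (∑-δ u f)

δ-⊙ : ∀ {n} (X : Matrix {n}) u w → (δ ⊙ X) u w ≡ X u w
δ-⊙ X u w = ∑-δ u (λ v → X v w)

⊙-δ : ∀ {n} (X : Matrix {n}) u w → (X ⊙ δ) u w ≡ X u w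
⊙-δ X u w = trans (∑-cong (allWords _) (λ v → cong (X u v *_) (δ-sym v w))) (∑-δʳ w (X u))

-- creation u w = (-1)^(number of ones of u before i) if w is u with its 0 at position i
-- turned into a 1, and 0 otherwise.
creation : ∀ {n} → Word n → Word n → ℤ
creation []          []          = + 0
creation (false ∷ u) (false ∷ w) = creation u w
creation (false ∷ u) (true ∷ w)  = δ u w
creation (true ∷ u)  (false ∷ w) = + 0
creation (true ∷ u)  (true ∷ w)  = - creation u w

creation-weight : ∀ {n} (u w : Word n) → creation u w ≡ + 0 ⊎ weight w ≡ suc (weight u)
creation-weight []          []          = inj₁ refl
creation-weight (false ∷ u) (false ∷ w) = creation-weight u w
creation-weight (false ∷ u) (true ∷ w)  with δ≡0⊎≡ u w
... | inj₁ δ≡0 = inj₁ δ≡0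
... | inj₂ refl = inj₂ refl
creation-weight (true ∷ u)  (false ∷ w) = inj₁ refl
creation-weight (true ∷ u)  (true ∷ w)  with creation-weight u w
... | inj₁ c≡0 = inj₁ (cong -_ c≡0)
... | inj₂ eq  = inj₂ (cong suc eq)

creation-off-weight : ∀ {n} (u w : Word n) → weight u ≡ suc (weight w) → creation u w ≡ + 0
creation-off-weight u w u≡1+w with creation-weight u w
... | inj₁ c≡0   = c≡0
... | inj₂ w≡1+u = ⊥-elim (m≢1+n+m (weight w) {1} (trans w≡1+u (cong suc u≡1+w)))

creation-square : ∀ {n} (u w : Word n) → (creation ⊙ creation) u w ≡ + 0
creation-square []          []          = refl
creation-square {suc n} (false ∷ u) (false ∷ w) =
  trans (∑-allWords-suc n _) (cong₂ _+_ (creation-square u w) (∑-δ u (λ _ → + 0)))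
creation-square {suc n} (false ∷ u) (true ∷ w)  =
  trans (∑-allWords-suc n _)
    (trans (cong₂ _+_ (⊙-δ creation u w) (∑-δ u (λ v → - creation v w))) (+-inverseʳ (creation u w)))
creation-square {suc n} (true ∷ u)  (false ∷ w) =
  trans (∑-allWords-suc n _) (cong₂ _+_ (∑-zero (allWords n)) (∑-*-zero (allWords n) (λ v → - creation u v)))
creation-square {suc n} (true ∷ u)  (true ∷ w)  =
  trans (∑-allWords-suc n _)
    (trans (cong₂ _+_ (∑-zero (allWords n)) (∑-neg-neg (allWords n) (creation u) (λ v → creation v w)))
           (trans (+-identityˡ _) (creation-square u w)))

hop : ∀ {n} → Matrix {n}
hop = creation ᵀ ⊙ creation

hop-ff : ∀ {n} (u w : Word n) → hop (false ∷ u) (false ∷ w) ≡ hop u w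
hop-ff {n} u w = trans (∑-allWords-suc n _) (trans (cong (_+_ (hop u w)) (∑-zero (allWords n))) (+-identityʳ _))

hop-ft : ∀ {n} (u w : Word n) → hop (false ∷ u) (true ∷ w) ≡ creation w u
hop-ft {n} u w = trans (∑-allWords-suc n _)
  (trans (cong₂ _+_ (⊙-δ (creation ᵀ) u w) (∑-zero (allWords n))) (+-identityʳ _))

hop-tf : ∀ {n} (u w : Word n) → hop (true ∷ u) (false ∷ w) ≡ creation u w
hop-tf {n} u w = trans (∑-allWords-suc n _)
  (trans (cong₂ _+_ (∑-δˡ u (λ v → creation v w)) (∑-*-zero (allWords n) (λ v → - creation v u))) (+-identityʳ _))

hop-tt : ∀ {n} (u w : Word n) → hop (true ∷ u) (true ∷ w) ≡ δ u w + hop u w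
hop-tt {n} u w = trans (∑-allWords-suc n _)
  (cong₂ _+_ (∑-δˡ u (λ v → δ v w)) (∑-neg-neg (allWords n) (λ v → creation v u) (λ v → creation v w)))

hop-sym : ∀ {n} (u w : Word n) → hop u w ≡ hop w u
hop-sym u w = ∑-cong (allWords _) (λ v → *-comm (creation v u) _)

hop-off-weight : ∀ {n} (u w : Word n) → weight u ≢ weight w → hop u w ≡ + 0
hop-off-weight {n} u w u≉w = trans (∑-cong (allWords n) term≡0) (∑-zero (allWords n))
  where
  term≡0 : ∀ v → creation v u * creation v w ≡ + 0
  term≡0 v with creation-weight v u | creation-weight v w
  ... | inj₁ c≡0 | _        = cong (_* creation v w) c≡0
  ... | inj₂ _   | inj₁ c≡0 = trans (cong (creation v u *_) c≡0) (*-zeroʳ (creation v u))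
  ... | inj₂ p   | inj₂ q   = ⊥-elim (u≉w (trans p (sym q)))

creation-anticommutator : ∀ {n} (u w : Word n) → hop u w + (creation ⊙ creation ᵀ) u w ≡ + n * δ u w
creation-anticommutator []          []          = refl
creation-anticommutator {suc n} (false ∷ u) (false ∷ w) = begin
  hop (false ∷ u) (false ∷ w) + (creation ⊙ creation ᵀ) (false ∷ u) (false ∷ w)
    ≡⟨ cong₂ _+_ (hop-ff u w)
                 (trans (∑-allWords-suc n _) (cong (_+_ ((creation ⊙ creation ᵀ) u w)) (∑-δ u (δ w)))) ⟩
  hop u w + ((creation ⊙ creation ᵀ) u w + δ w u)
    ≡⟨ sym (+-assoc (hop u w) _ _) ⟩
  hop u w + (creation ⊙ creation ᵀ) u w + δ w u
    ≡⟨ cong₂ _+_ (creation-anticommutator u w) (δ-sym w u) ⟩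
  + n * δ u w + δ u w
    ≡⟨ trans (+-comm (+ n * δ u w) _) (sym (suc-* (+ n) (δ u w))) ⟩
  + suc n * δ u w ∎
  where open ≡-Reasoning
creation-anticommutator {suc n} (false ∷ u) (true ∷ w)  = begin
  hop (false ∷ u) (true ∷ w) + (creation ⊙ creation ᵀ) (false ∷ u) (true ∷ w)
    ≡⟨ cong₂ _+_ (hop-ft u w) (trans (∑-allWords-suc n _)
                                      (cong₂ _+_ (∑-*-zero (allWords n) (creation u)) (∑-δ u (λ v → - creation w v)))) ⟩
  creation w u + (+ 0 + - creation w u)
    ≡⟨ trans (cong (_+_ (creation w u)) (+-identityˡ _)) (+-inverseʳ (creation w u)) ⟩
  + 0
    ≡⟨ sym (*-zeroʳ (+ suc n)) ⟩
  + suc n * + 0 ∎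
  where open ≡-Reasoning
creation-anticommutator {suc n} (true ∷ u)  (false ∷ w) = begin
  hop (true ∷ u) (false ∷ w) + (creation ⊙ creation ᵀ) (true ∷ u) (false ∷ w)
    ≡⟨ cong₂ _+_ (hop-tf u w) (trans (∑-allWords-suc n _)
                                      (cong₂ _+_ (∑-zero (allWords n)) (∑-δʳ w (λ v → - creation u v)))) ⟩
  creation u w + (+ 0 + - creation u w)
    ≡⟨ trans (cong (_+_ (creation u w)) (+-identityˡ _)) (+-inverseʳ (creation u w)) ⟩
  + 0
    ≡⟨ sym (*-zeroʳ (+ suc n)) ⟩
  + suc n * + 0 ∎
  where open ≡-Reasoning
creation-anticommutator {suc n} (true ∷ u)  (true ∷ w)  = begin
  hop (true ∷ u) (true ∷ w) + (creation ⊙ creation ᵀ) (true ∷ u) (true ∷ w)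
    ≡⟨ cong₂ _+_ (hop-tt u w) (trans (∑-allWords-suc n _)
                                      (cong₂ _+_ (∑-zero (allWords n)) (∑-neg-neg (allWords n) (creation u) (creation w)))) ⟩
  δ u w + hop u w + (+ 0 + (creation ⊙ creation ᵀ) u w)
    ≡⟨ cong (_+_ (δ u w + hop u w)) (+-identityˡ _) ⟩
  δ u w + hop u w + (creation ⊙ creation ᵀ) u w
    ≡⟨ +-assoc (δ u w) _ _ ⟩
  δ u w + (hop u w + (creation ⊙ creation ᵀ) u w)
    ≡⟨ cong (_+_ (δ u w)) (creation-anticommutator u w) ⟩
  δ u w + + n * δ u w
    ≡⟨ sym (suc-* (+ n) (δ u w)) ⟩
  + suc n * δ u w ∎
  where open ≡-Reasoning

creation-creationᵀ : ∀ {n} (u w : Word n) → (creation ⊙ creation ᵀ) u w ≡ + n * δ u w - hop u w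
creation-creationᵀ {n} u w = begin
  (creation ⊙ creation ᵀ) u w                       ≡⟨ add-sub (hop u w) _ ⟩
  hop u w + (creation ⊙ creation ᵀ) u w - hop u w   ≡⟨ cong (_- hop u w) (creation-anticommutator u w) ⟩
  + n * δ u w - hop u w                             ∎
  where
  open ≡-Reasoning
  add-sub : ∀ a b → b ≡ a + b - a
  add-sub = solve-∀

hop-creation : ∀ {n} (u w : Word n) → (hop ⊙ creation) u w ≡ + 0
hop-creation {n} u w = begin
  (creation ᵀ ⊙ creation ⊙ creation) u w
    ≡⟨ ⊙-assoc (creation ᵀ) creation creation u w ⟩
  ∑ (allWords n) (λ v → creation v u * (creation ⊙ creation) v w)
    ≡⟨ ∑-cong (allWords n) (λ v → cong (creation v u *_) (creation-square v w)) ⟩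
  ∑ (allWords n) (λ v → creation v u * + 0)
    ≡⟨ ∑-*-zero (allWords n) (λ v → creation v u) ⟩
  + 0 ∎
  where open ≡-Reasoning

creation-creationᵀ-creation : ∀ {n} (u w : Word n) → (creation ⊙ creation ᵀ ⊙ creation) u w ≡ + n * creation u w
creation-creationᵀ-creation {n} u w = begin
  ∑ (allWords n) (λ v → (creation ⊙ creation ᵀ) u v * creation v w)
    ≡⟨ ∑-cong (allWords n) (λ v → trans (cong (_* creation v w) (creation-creationᵀ u v))
                                        (distrib (+ n) (δ u v) (hop u v) _)) ⟩
  ∑ (allWords n) (λ v → + n * (δ u v * creation v w) - hop u v * creation v w)
    ≡⟨ ∑-- (allWords n) _ _ ⟩
  ∑ (allWords n) (λ v → + n * (δ u v * creation v w)) - (hop ⊙ creation) u w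
    ≡⟨ cong₂ _-_ (trans (∑-*ˡ (allWords n) (+ n) _) (cong (+ n *_) (δ-⊙ creation u w))) (hop-creation u w) ⟩
  + n * creation u w - + 0
    ≡⟨ +-identityʳ _ ⟩
  + n * creation u w ∎
  where
  open ≡-Reasoning
  distrib : ∀ m e h c → (m * e - h) * c ≡ m * (e * c) - h * c
  distrib = solve-∀

hop-square : ∀ {n} (u w : Word n) → (hop ⊙ hop) u w ≡ + n * hop u w
hop-square {n} u w = begin
  (creation ᵀ ⊙ creation ⊙ hop) u w
    ≡⟨ ⊙-assoc (creation ᵀ) creation hop u w ⟩
  ∑ (allWords n) (λ v → creation v u * (creation ⊙ hop) v w)
    ≡⟨ ∑-cong (allWords n) (λ v → cong (creation v u *_) (creation-hop v)) ⟩
  ∑ (allWords n) (λ v → creation v u * (+ n * creation v w))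
    ≡⟨ ∑-cong (allWords n) (λ v → swap (creation v u) (+ n) _) ⟩
  ∑ (allWords n) (λ v → + n * (creation v u * creation v w))
    ≡⟨ ∑-*ˡ (allWords n) (+ n) _ ⟩
  + n * hop u w ∎
  where
  open ≡-Reasoning
  swap : ∀ a m b → a * (m * b) ≡ m * (a * b)
  swap = solve-∀
  creation-hop : ∀ v → (creation ⊙ hop) v w ≡ + n * creation v w
  creation-hop v = trans (sym (⊙-assoc creation (creation ᵀ) creation v w)) (creation-creationᵀ-creation v w)

shiftedHop : ∀ {n} → ℤ → Matrix {n}
shiftedHop c u w = hop u w - c * δ u w

shiftedHop-sym : ∀ {n} c (u w : Word n) → shiftedHop c u w ≡ shiftedHop c w u
shiftedHop-sym c u w = cong₂ (λ a e → a - c * e) (hop-sym u w) (δ-sym u w)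

shiftedHop-off-weight : ∀ {n} c (u w : Word n) → weight u ≢ weight w → shiftedHop c u w ≡ + 0
shiftedHop-off-weight c u w u≉w with δ≡0⊎≡ u w
... | inj₂ refl = ⊥-elim (u≉w refl)
... | inj₁ δ≡0  = trans (cong₂ (λ a e → a - c * e) (hop-off-weight u w u≉w) δ≡0) (sub-*-zeroʳ (+ 0) c)

shiftedHop-square : ∀ {n} c (u w : Word n) →
  (shiftedHop c ⊙ shiftedHop c) u w ≡ (+ n - (c + c)) * hop u w + c * c * δ u w
shiftedHop-square {n} c u w = begin
  ∑ W (λ v → (hop u v - c * δ u v) * (hop v w - c * δ v w))
    ≡⟨ ∑-cong W (λ v → expand (hop u v) (hop v w) (δ u v) (δ v w) c) ⟩
  ∑ W (λ v → hop u v * hop v w - c * (δ u v * hop v w) - c * (hop u v * δ v w) + c * c * (δ u v * δ v w))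
    ≡⟨ ∑-+ W _ _ ⟩
  ∑ W (λ v → hop u v * hop v w - c * (δ u v * hop v w) - c * (hop u v * δ v w))
    + ∑ W (λ v → c * c * (δ u v * δ v w))
    ≡⟨ cong₂ _+_ (trans (∑-- W _ _) (cong₂ _-_ (∑-- W _ _) refl)) refl ⟩
  (hop ⊙ hop) u w - ∑ W (λ v → c * (δ u v * hop v w)) - ∑ W (λ v → c * (hop u v * δ v w))
    + ∑ W (λ v → c * c * (δ u v * δ v w))
    ≡⟨ cong₂ _+_ (cong₂ _-_ (cong₂ _-_ (hop-square u w) (scaled c _ (δ-⊙ hop u w))) (scaled c _ (⊙-δ hop u w)))
                 (scaled (c * c) _ (δ-⊙ δ u w)) ⟩
  + n * hop u w - c * hop u w - c * hop u w + c * c * δ u w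
    ≡⟨ collect (+ n) c (hop u w) (δ u w) ⟩
  (+ n - (c + c)) * hop u w + c * c * δ u w ∎
  where
  open ≡-Reasoning
  W = allWords n
  scaled : ∀ k (t : Word n → ℤ) {a} → ∑ W t ≡ a → ∑ W (λ v → k * t v) ≡ k * a
  scaled k t ∑t≡a = trans (∑-*ˡ W k t) (cong (k *_) ∑t≡a)
  expand : ∀ a b e f c → (a - c * e) * (b - c * f) ≡ a * b - c * (e * b) - c * (a * f) + c * c * (e * f)
  expand = solve-∀
  collect : ∀ m c h e → m * h - c * h - c * h + c * c * e ≡ (m - (c + c)) * h + c * c * e
  collect = solve-∀

filter-map : ∀ {A B : Set} {ℓ} {P : Pred B ℓ} (P? : Decidable P) (f : A → B) xs →
             filter P? (map f xs) ≡ map f (filter (λ x → P? (f x)) xs)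
filter-map P? f []       = refl
filter-map P? f (x ∷ xs) with does (P? (f x))
... | true  = cong (f x ∷_) (filter-map P? f xs)
... | false = filter-map P? f xs

null-map : ∀ {A B : Set} {f : A → B} (xs : List A) → null (map f xs) ≡ null xs
null-map []      = refl
null-map (_ ∷ _) = refl

positions : ∀ {n} → (Fin n → Bool) → List (Fin n)
positions {n} p = filter (λ i → p i ≟B true) (allFin n)

positions-suc : ∀ {n} (p : Fin (suc n) → Bool) →
  positions p ≡ (if p zero then zero ∷ map suc (positions (λ i → p (suc i))) else map suc (positions (λ i → p (suc i))))
positions-suc {n} p with p zero
... | true  = cong (zero ∷_) shifted
  where shifted = trans (cong (filter _) (sym (map-tabulate (λ i → i) suc))) (filter-map _ suc (allFin n))
... | false = trans (cong (filter _) (sym (map-tabulate (λ i → i) suc))) (filter-map _ suc (allFin n))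

differAt : ∀ {n} → Word n → Word n → Fin n → Bool
differAt u w i = not (does (lookup u i ≟B lookup w i))

commonOneBetween : ∀ {n} → Word n → Word n → Fin n → Fin n → Fin n → Bool
commonOneBetween u w i j ℓ = lookup u ℓ ∧ lookup w ℓ ∧ (toℕ i ℕ.<ᵇ toℕ ℓ) ∧ (toℕ ℓ ℕ.<ᵇ toℕ j)

commonOneBefore : ∀ {n} → Word n → Word n → Fin n → Fin n → Bool
commonOneBefore u w j ℓ = lookup u ℓ ∧ lookup w ℓ ∧ (toℕ ℓ ℕ.<ᵇ toℕ j)

commonOnesBefore : ∀ {n} → Word n → Word n → Fin n → ℕ
commonOnesBefore u w j = length (positions (commonOneBefore u w j))

diffPositions-same : ∀ {n} a (u w : Word n) → diffPositions (a ∷ u) (a ∷ w) ≡ map suc (diffPositions u w)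
diffPositions-same false u w = positions-suc (differAt (false ∷ u) (false ∷ w))
diffPositions-same true  u w = positions-suc (differAt (true ∷ u) (true ∷ w))

diffPositions-flip : ∀ {n} a (u w : Word n) → diffPositions (a ∷ u) (not a ∷ w) ≡ zero ∷ map suc (diffPositions u w)
diffPositions-flip false u w = positions-suc (differAt (false ∷ u) (true ∷ w))
diffPositions-flip true  u w = positions-suc (differAt (true ∷ u) (false ∷ w))

null-diffPositions : ∀ {n} (u w : Word n) → null (diffPositions u w) ≡ does (≡-dec _≟B_ u w)
null-diffPositions []          []          = refl
null-diffPositions (false ∷ u) (false ∷ w) =
  trans (cong null (diffPositions-same false u w)) (trans (null-map (diffPositions u w)) (null-diffPositions u w))
null-diffPositions (true ∷ u)  (true ∷ w)  =
  trans (cong null (diffPositions-same true u w)) (trans (null-map (diffPositions u w)) (null-diffPositions u w))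
null-diffPositions (false ∷ u) (true ∷ w)  = cong null (diffPositions-flip false u w)
null-diffPositions (true ∷ u)  (false ∷ w) = cong null (diffPositions-flip true u w)

h-same : ∀ {n} a (u w : Word n) i j → h (a ∷ u) (a ∷ w) (suc i) (suc j) ≡ h u w i j
h-same false u w i j =
  trans (cong length (positions-suc (commonOneBetween (false ∷ u) (false ∷ w) (suc i) (suc j))))
    (length-map suc (positions (commonOneBetween u w i j)))
h-same true  u w i j =
  trans (cong length (positions-suc (commonOneBetween (true ∷ u) (true ∷ w) (suc i) (suc j))))
    (length-map suc (positions (commonOneBetween u w i j)))

h-flip : ∀ {n} a (u w : Word n) j → h (a ∷ u) (not a ∷ w) zero (suc j) ≡ commonOnesBefore u w j
h-flip false u w j =
  trans (cong length (positions-suc (commonOneBetween (false ∷ u) (true ∷ w) zero (suc j))))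
    (length-map suc (positions (commonOneBefore u w j)))
h-flip true  u w j =
  trans (cong length (positions-suc (commonOneBetween (true ∷ u) (false ∷ w) zero (suc j))))
    (length-map suc (positions (commonOneBefore u w j)))

commonOnesBefore-same : ∀ {n} a (u w : Word n) j →
  commonOnesBefore (a ∷ u) (a ∷ w) (suc j) ≡ (if a then suc (commonOnesBefore u w j) else commonOnesBefore u w j)
commonOnesBefore-same false u w j =
  trans (cong length (positions-suc (commonOneBefore (false ∷ u) (false ∷ w) (suc j))))
    (length-map suc (positions (commonOneBefore u w j)))
commonOnesBefore-same true  u w j =
  trans (cong length (positions-suc (commonOneBefore (true ∷ u) (true ∷ w) (suc j))))
    (cong suc (length-map suc (positions (commonOneBefore u w j))))

commonOnesBefore-zero : ∀ {n} (u w : Word (suc n)) → commonOnesBefore u w zero ≡ 0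
commonOnesBefore-zero {n} u w =
  cong length (filter-none (λ ℓ → commonOneBefore u w zero ℓ ≟B true) (universal never (allFin (suc n))))
  where
  <ᵇ-zero : ∀ m → (m ℕ.<ᵇ 0) ≡ false
  <ᵇ-zero zero    = refl
  <ᵇ-zero (suc m) = refl
  never : ∀ ℓ → commonOneBefore u w zero ℓ ≢ true
  never ℓ rewrite <ᵇ-zero (toℕ ℓ) | ∧-zeroʳ (lookup w ℓ) | ∧-zeroʳ (lookup u ℓ) = λ ()

singleDiffEntry : ∀ {n} → Word n → Word n → ℤ
singleDiffEntry u w with diffPositions u w
... | j ∷ [] = negOnePow (commonOnesBefore u w j)
... | _      = + 0

singleDiffEntry-ff : ∀ {n} (u w : Word n) → singleDiffEntry (false ∷ u) (false ∷ w) ≡ singleDiffEntry u w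
singleDiffEntry-ff u w rewrite diffPositions-same false u w with diffPositions u w
... | []        = refl
... | j ∷ []    = cong negOnePow (commonOnesBefore-same false u w j)
... | _ ∷ _ ∷ _ = refl

singleDiffEntry-tt : ∀ {n} (u w : Word n) → singleDiffEntry (true ∷ u) (true ∷ w) ≡ - singleDiffEntry u w
singleDiffEntry-tt u w rewrite diffPositions-same true u w with diffPositions u w
... | []        = refl
... | j ∷ []    = cong negOnePow (commonOnesBefore-same true u w j)
... | _ ∷ _ ∷ _ = refl

singleDiffEntry-flip : ∀ {n} a (u w : Word n) → singleDiffEntry (a ∷ u) (not a ∷ w) ≡ δ u w
singleDiffEntry-flip a u w rewrite diffPositions-flip a u w | sym (null-diffPositions u w) with diffPositions u w
... | []    = cong negOnePow (commonOnesBefore-zero (a ∷ u) (not a ∷ w))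
... | _ ∷ _ = refl

singleDiffEntry-creation : ∀ {n} (u w : Word n) → singleDiffEntry u w ≡ creation u w + creation w u
singleDiffEntry-creation []          []          = refl
singleDiffEntry-creation (false ∷ u) (false ∷ w) = trans (singleDiffEntry-ff u w) (singleDiffEntry-creation u w)
singleDiffEntry-creation (true ∷ u)  (true ∷ w)  =
  trans (singleDiffEntry-tt u w) (trans (cong -_ (singleDiffEntry-creation u w)) (neg-distrib-+ (creation u w) (creation w u)))
singleDiffEntry-creation (false ∷ u) (true ∷ w)  = trans (singleDiffEntry-flip false u w) (sym (+-identityʳ _))
singleDiffEntry-creation (true ∷ u)  (false ∷ w) =
  trans (singleDiffEntry-flip true u w) (trans (δ-sym u w) (sym (+-identityˡ _)))

Aentry-same : ∀ {n} a (u w : Word n) → Aentry (a ∷ u) (a ∷ w) ≡ Aentry u w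
Aentry-same a u w rewrite diffPositions-same a u w with diffPositions u w
... | []            = refl
... | _ ∷ []        = refl
... | i ∷ j ∷ []    = cong negOnePow (h-same a u w i j)
... | _ ∷ _ ∷ _ ∷ _ = refl

Aentry-flip : ∀ {n} a (u w : Word n) → Aentry (a ∷ u) (not a ∷ w) ≡ singleDiffEntry u w
Aentry-flip a u w rewrite diffPositions-flip a u w with diffPositions u w
... | []        = refl
... | j ∷ []    = cong negOnePow (h-flip a u w j)
... | _ ∷ _ ∷ _ = refl

Aentry-hop : ∀ {n} (u w : Word n) → weight u ≡ weight w → Aentry u w ≡ hop u w - + weight u * δ u w
Aentry-hop []          []          _ = refl
Aentry-hop (false ∷ u) (false ∷ w) e =
  trans (Aentry-same false u w) (trans (Aentry-hop u w e) (cong (_- + weight u * δ u w) (sym (hop-ff u w))))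
Aentry-hop (true ∷ u)  (true ∷ w)  e =
  trans (Aentry-same true u w)
    (trans (Aentry-hop u w (suc-injective e))
      (trans (shift (hop u w) (δ u w) (+ weight u)) (cong (_- + suc (weight u) * δ u w) (sym (hop-tt u w)))))
  where
  shift : ∀ a e x → a - x * e ≡ e + a - (+ 1 + x) * e
  shift = solve-∀
Aentry-hop (false ∷ u) (true ∷ w)  e = begin
  Aentry (false ∷ u) (true ∷ w)                 ≡⟨ Aentry-flip false u w ⟩
  singleDiffEntry u w                           ≡⟨ singleDiffEntry-creation u w ⟩
  creation u w + creation w u                   ≡⟨ cong (_+ creation w u) (creation-off-weight u w e) ⟩
  + 0 + creation w u                            ≡⟨ +-identityˡ _ ⟩
  creation w u                                  ≡⟨ sym (hop-ft u w) ⟩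
  hop (false ∷ u) (true ∷ w)                    ≡⟨ sym (sub-*-zeroʳ _ (+ weight u)) ⟩
  hop (false ∷ u) (true ∷ w) - + weight u * + 0 ∎
  where open ≡-Reasoning
Aentry-hop (true ∷ u)  (false ∷ w) e = begin
  Aentry (true ∷ u) (false ∷ w)                       ≡⟨ Aentry-flip true u w ⟩
  singleDiffEntry u w                                 ≡⟨ singleDiffEntry-creation u w ⟩
  creation u w + creation w u                         ≡⟨ cong (_+_ (creation u w)) (creation-off-weight w u (sym e)) ⟩
  creation u w + + 0                                  ≡⟨ +-identityʳ _ ⟩
  creation u w                                        ≡⟨ sym (hop-tf u w) ⟩
  hop (true ∷ u) (false ∷ w)                          ≡⟨ sym (sub-*-zeroʳ _ (+ suc (weight u))) ⟩
  hop (true ∷ u) (false ∷ w) - + suc (weight u) * + 0 ∎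
  where open ≡-Reasoning

Aentry-shiftedHop : ∀ {n d} (u w : Word n) → weight u ≡ d → weight w ≡ d → Aentry u w ≡ shiftedHop (+ d) u w
Aentry-shiftedHop u w refl w≡d = Aentry-hop u w (sym w≡d)

weight-∈-B : ∀ {n d} {α : Word n} → α ∈ B n d → weight α ≡ d
weight-∈-B {n} {d} α∈B = proj₂ (∈-filter⁻ (λ v → weight v ≟ℕ d) {xs = allWords n} α∈B)

AAT-shiftedHop : ∀ n d (α β : Word n) → α ∈ B n d → β ∈ B n d →
  AAT n d α β ≡ (shiftedHop (+ d) ⊙ shiftedHop (+ d)) α β
AAT-shiftedHop n d α β α∈B β∈B = ∑-filter (λ v → weight v ≟ℕ d) _ _ agree vanish (allWords n)
  where
  agree : ∀ γ → weight γ ≡ d → Aentry α γ * Aentry β γ ≡ shiftedHop (+ d) α γ * shiftedHop (+ d) γ β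
  agree γ γ∈B = cong₂ _*_ (Aentry-shiftedHop α γ (weight-∈-B α∈B) γ∈B)
                          (trans (Aentry-shiftedHop β γ (weight-∈-B β∈B) γ∈B) (shiftedHop-sym (+ d) β γ))
  vanish : ∀ γ → weight γ ≢ d → shiftedHop (+ d) α γ * shiftedHop (+ d) γ β ≡ + 0
  vanish γ γ∉B = cong (_* shiftedHop (+ d) γ β)
    (shiftedHop-off-weight (+ d) α γ (λ α≈γ → γ∉B (trans (sym α≈γ) (weight-∈-B α∈B))))

length-filter-allWords-suc : ∀ {n ℓ} {P : Pred (Word (suc n)) ℓ} (P? : Decidable P) →
  length (filter P? (allWords (suc n)))
    ≡ length (filter (λ w → P? (false ∷ w)) (allWords n)) ℕ.+ length (filter (λ w → P? (true ∷ w)) (allWords n))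
length-filter-allWords-suc {n} P? = go (allWords n)
  where
  go : ∀ ws → length (filter P? (concatMap (λ w → (false ∷ w) ∷ (true ∷ w) ∷ []) ws))
            ≡ length (filter (λ w → P? (false ∷ w)) ws) ℕ.+ length (filter (λ w → P? (true ∷ w)) ws)
  go []       = refl
  go (w ∷ ws) with does (P? (false ∷ w))
  ... | true  with does (P? (true ∷ w))
  ...   | true  = cong suc (trans (cong suc (go ws)) (sym (+-suc _ _)))
  ...   | false = cong suc (go ws)
  go (w ∷ ws) | false with does (P? (true ∷ w))
  ...   | true  = trans (cong suc (go ws)) (sym (+-suc _ _))
  ...   | false = go ws

length-B : ∀ n d → length (B n d) ≡ n C d
length-B zero    zero    = refl
length-B zero    (suc d) = refl
length-B (suc n) zero    = trans (length-filter-allWords-suc {n} (λ v → weight v ≟ℕ 0))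
  (cong₂ ℕ._+_ (length-B n 0) (cong length (filter-none (λ w → suc (weight w) ≟ℕ 0) (universal (λ w ()) (allWords n)))))
length-B (suc n) (suc d) = begin
  length (B (suc n) (suc d))
    ≡⟨ length-filter-allWords-suc {n} (λ v → weight v ≟ℕ suc d) ⟩
  length (B n (suc d)) ℕ.+ length (filter (λ w → suc (weight w) ≟ℕ suc d) (allWords n))
    ≡⟨ cong (length (B n (suc d)) ℕ.+_) (cong length (filter-≐ _ _ (suc-injective , cong suc) (allWords n))) ⟩
  length (B n (suc d)) ℕ.+ length (B n d)
    ≡⟨ cong₂ ℕ._+_ (length-B n (suc d)) (length-B n d) ⟩
  n C suc d ℕ.+ n C d
    ≡⟨ ℕ-+-comm (n C suc d) _ ⟩
  n C d ℕ.+ n C suc d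
    ≡⟨ nCk+nC[k+1]≡[n+1]C[k+1] n d ⟩
  suc n C suc d ∎
  where open ≡-Reasoning

proposition5p12 : (d : ℕ) → 1 ≤ d →
    (length (B (d ℕ.+ d) d) ≡ (d ℕ.+ d) C d)
    × (∀ α β → α ∈ B (d ℕ.+ d) d → β ∈ B (d ℕ.+ d) d →
         AAT (d ℕ.+ d) d α β ≡ (+ (d ℕ.* d)) * δ α β)
proposition5p12 d _ = length-B (d ℕ.+ d) d , weighing
  where
  weighing : ∀ α β → α ∈ B (d ℕ.+ d) d → β ∈ B (d ℕ.+ d) d → AAT (d ℕ.+ d) d α β ≡ + (d ℕ.* d) * δ α β
  weighing α β α∈B β∈B = begin
    AAT (d ℕ.+ d) d α β                                     ≡⟨ AAT-shiftedHop (d ℕ.+ d) d α β α∈B β∈B ⟩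
    (shiftedHop (+ d) ⊙ shiftedHop (+ d)) α β               ≡⟨ shiftedHop-square (+ d) α β ⟩
    (+ d + + d - (+ d + + d)) * hop α β + + d * + d * δ α β ≡⟨ balance (+ d) (hop α β) (δ α β) ⟩
    + d * + d * δ α β                                       ≡⟨ cong (_* δ α β) (sym (pos-* d d)) ⟩
    + (d ℕ.* d) * δ α β                                     ∎
    where
    open ≡-Reasoning
    balance : ∀ x h e → (x + x - (x + x)) * h + x * x * e ≡ x * x * e
    balance = solve-∀
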